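{- Let $\mathbb{F}$ be a finite field of characteristic $q>2$ and $f(\bar x)=\prod_{i=1}^n(1-x_i)-2$. If $g(\bar x)$ is a multilinear polynomial with $g(\bar x)\cdot f(\bar x)=1\pmod{\bar x^2-\bar x}$, then $\deg g=n$.
   Context: "mod $\bar x^2-\bar x$" means modulo the ideal generated by $x_i^2-x_i$, $i\in[n]$. -}

module Defs where

open import Level using (Level; _⊔_)
open import Algebra.Bundles using (CommutativeRing)
open import Data.Nat using (ℕ; zero; suc; _<_; _≤_)
open import Data.Fin using (Fin)
open import Data.Bool using (Bool; true; false)
import Data.Bool as Bool
open import Data.Vec using (Vec; []; _∷_; replicate; tabulate)
open import Data.Vec.Properties using (≡-dec)
open import Data.List using (List; []; _∷_; _++_; map; foldr; concatMap)
open import Data.Fin.Subset using (Subset; _∪_; ∣_∣; ⁅_⁆)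
open import Data.Product using (Σ; ∃; _×_; _,_)
open import Data.Sum using (_⊎_)
open import Relation.Nullary using (¬_; yes; no)
open import Relation.Binary.PropositionalEquality using (_≡_)

IsField : ∀ {c ℓ} → CommutativeRing c ℓ → Set (c ⊔ ℓ)
IsField R = ¬ (1# ≈ 0#) × (∀ x → ¬ (x ≈ 0#) → Σ Carrier λ y → (x * y) ≈ 1#)
  where open CommutativeRing R

IsFinite : ∀ {c ℓ} → CommutativeRing c ℓ → Set (c ⊔ ℓ)
IsFinite R = Σ ℕ λ m → Σ (Fin m → Carrier) λ e → ∀ x → Σ (Fin m) λ i → e i ≈ x
  where open CommutativeRing R

module _ {c ℓ} (R : CommutativeRing c ℓ) where
  open CommutativeRing R

  _×1 : ℕ → Carrier
  zero ×1 = 0#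
  suc m ×1 = 1# + (m ×1)

  HasCharacteristic : ℕ → Set ℓ
  HasCharacteristic q = (0 < q) × ((q ×1) ≈ 0#) × (∀ m → 0 < m → m < q → ¬ ((m ×1) ≈ 0#))

  -- Multilinear polynomials in x_1..x_n: coefficient of the monomial
  -- ∏_{i∈S} x_i, indexed by S : Subset n.
  MLPoly : ℕ → Set c
  MLPoly n = Subset n → Carrier

  allSubsets : (n : ℕ) → List (Subset n)
  allSubsets zero = [] ∷ []
  allSubsets (suc n) = map (false ∷_) (allSubsets n) ++ map (true ∷_) (allSubsets n)

  sumL : List Carrier → Carrier
  sumL = foldr _+_ 0#

  constP : ∀ {n} → Carrier → MLPoly n
  constP {n} a S with ≡-dec Bool._≟_ S (replicate n false)
  ... | yes _ = a
  ... | no _ = 0#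

  varP : ∀ {n} → Fin n → MLPoly n
  varP i S with ≡-dec Bool._≟_ S ⁅ i ⁆
  ... | yes _ = 1#
  ... | no _ = 0#

  _+P_ : ∀ {n} → MLPoly n → MLPoly n → MLPoly n
  (p +P q) S = p S + q S

  _-P_ : ∀ {n} → MLPoly n → MLPoly n → MLPoly n
  (p -P q) S = p S - q S

  -- product modulo the ideal (x_i^2 - x_i): x^A · x^B reduces to x^(A ∪ B)
  _*P_ : ∀ {n} → MLPoly n → MLPoly n → MLPoly n
  _*P_ {n} p q S = sumL (concatMap (λ A → map (λ B → term A B) (allSubsets n)) (allSubsets n))
    where
      term : Subset n → Subset n → Carrier
      term A B with ≡-dec Bool._≟_ (A ∪ B) S
      ... | yes _ = p A * q B
      ... | no _ = 0#

  _≈P_ : ∀ {n} → MLPoly n → MLPoly n → Set ℓ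
  p ≈P q = ∀ S → p S ≈ q S

  fPoly : (n : ℕ) → MLPoly n
  fPoly n = foldr (λ i acc → (constP 1# -P varP i) *P acc) (constP 1#) (Data.List.allFin n)
            -P constP (1# + 1#)

  HasDegree : ∀ {n} → MLPoly n → ℕ → Set ℓ
  HasDegree {n} p d = (Σ (Subset n) λ S → (∣ S ∣ ≡ d) × ¬ (p S ≈ 0#))
                    × (∀ S → ¬ (p S ≈ 0#) → ∣ S ∣ ≤ d)

-- Modulo xᵢ² - xᵢ, multilinear polynomials are functions on {0,1}ⁿ and
-- e₀ = ∏ᵢ (1 - xᵢ) is the indicator of 0, so g e₀ = g(0) e₀, whose top
-- coefficient is (-1)ⁿ g(0). Comparing constant coefficients in g (e₀ - 2) = 1
-- gives g(0) - 2 g(0) = 1, so g(0) = -1. For n > 0 the top coefficient of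
-- g (e₀ - 2) vanishes, so 2 g⊤ = (-1)ⁿ g(0) ≠ 0 and the coefficient g⊤ of
-- x₁⋯xₙ is nonzero. Both coefficient computations go by induction on n,
-- writing each polynomial as p₀ + x₀ p₁ with p₀, p₁ free of x₀.
module Submission where

open import Defs
open import Algebra.Bundles using (CommutativeRing)
open import Data.Bool using (Bool; true; false)
import Data.Bool as Bool
open import Data.Fin using (Fin; zero; suc)
open import Data.Fin.Subset using (Subset; _∪_; ⁅_⁆; ⊥; ⊤)
open import Data.Fin.Subset.Properties using (∣⊤∣≡n; ∣p∣≤n)
open import Data.List using (List; []; _∷_; _++_; map; foldr; concatMap; allFin)
open import Data.List.Properties using (map-++; map-∘; map-tabulate)
open import Data.Nat using (ℕ; zero; suc; _<_)
open import Data.Product using (_,_)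
open import Data.Vec using ([]; _∷_)
open import Data.Vec.Properties using (≡-dec)
open import Function using (_∘_)
open import Relation.Nullary using (¬_; does; yes; no)
open import Relation.Nullary.Decidable using (dec-true)
import Relation.Binary.PropositionalEquality as ≡
import Algebra.Properties.Ring as RingProperties
import Algebra.Properties.CommutativeSemigroup as CommutativeSemigroupProperties
import Relation.Binary.Reasoning.Setoid as SetoidReasoning

module Coefficients {c ℓ} (F : CommutativeRing c ℓ) where
  open CommutativeRing F hiding (zero)
  open RingProperties ring using (-0#≈0#; -‿injective; +-inverseˡ-unique; -‿distribˡ-*; -‿+-comm; -1*x≈-x; xyx⁻¹≈y)
  open CommutativeSemigroupProperties +-commutativeSemigroup using (interchange)
  open SetoidReasoning setoid

  private
    variable
      n : ℕ
      x y : Carrier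

  infixr 7 [_]·_

  [_]·_ : Bool → Carrier → Carrier
  [ true ]· x = x
  [ false ]· x = 0#

  []·-cong : ∀ b → x ≈ y → [ b ]· x ≈ [ b ]· y
  []·-cong true x≈y = x≈y
  []·-cong false _ = refl

  []·-zero : ∀ b → [ b ]· 0# ≈ 0#
  []·-zero true = refl
  []·-zero false = refl

  []·-+ : ∀ b x y → [ b ]· (x + y) ≈ [ b ]· x + [ b ]· y
  []·-+ true x y = refl
  []·-+ false x y = sym (+-identityˡ 0#)

  []·-neg : ∀ b x → [ b ]· (- x) ≈ - ([ b ]· x)
  []·-neg true x = refl
  []·-neg false x = sym -0#≈0#

  infix 4 _==_

  _==_ : Subset n → Subset n → Bool
  S == T = does (≡-dec Bool._≟_ S T)

  ∑⟨_⟩ : ∀ {a} {A : Set a} → List A → (A → Carrier) → Carrier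
  ∑⟨ xs ⟩ f = sumL F (map f xs)

  sumL-++ : (xs ys : List Carrier) → sumL F (xs ++ ys) ≈ sumL F xs + sumL F ys
  sumL-++ [] ys = sym (+-identityˡ _)
  sumL-++ (x ∷ xs) ys = trans (+-congˡ (sumL-++ xs ys)) (sym (+-assoc _ _ _))

  module _ {a} {A : Set a} where

    ∑-cong : ∀ (xs : List A) {f g : A → Carrier} → (∀ x → f x ≈ g x) → ∑⟨ xs ⟩ f ≈ ∑⟨ xs ⟩ g
    ∑-cong [] f≈g = refl
    ∑-cong (x ∷ xs) f≈g = +-cong (f≈g x) (∑-cong xs f≈g)

    ∑-zero : ∀ (xs : List A) → ∑⟨ xs ⟩ (λ _ → 0#) ≈ 0#
    ∑-zero [] = refl
    ∑-zero (x ∷ xs) = trans (+-identityˡ _) (∑-zero xs)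

    ∑-+ : ∀ (xs : List A) (f g : A → Carrier) → ∑⟨ xs ⟩ (λ x → f x + g x) ≈ ∑⟨ xs ⟩ f + ∑⟨ xs ⟩ g
    ∑-+ [] f g = sym (+-identityˡ 0#)
    ∑-+ (x ∷ xs) f g = trans (+-congˡ (∑-+ xs f g)) (interchange _ _ _ _)

    ∑-++ : ∀ (xs ys : List A) (f : A → Carrier) → ∑⟨ xs ++ ys ⟩ f ≈ ∑⟨ xs ⟩ f + ∑⟨ ys ⟩ f
    ∑-++ xs ys f = trans (reflexive (≡.cong (sumL F) (map-++ f xs ys))) (sumL-++ (map f xs) _)

    sumL-concatMap : ∀ (xs : List A) (f : A → List Carrier) → sumL F (concatMap f xs) ≈ ∑⟨ xs ⟩ (sumL F ∘ f)
    sumL-concatMap [] f = refl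
    sumL-concatMap (x ∷ xs) f = trans (sumL-++ (f x) _) (+-congˡ (sumL-concatMap xs f))

  ∑-map : ∀ {a b} {A : Set a} {B : Set b} (xs : List A) (g : A → B) (f : B → Carrier) →
          ∑⟨ map g xs ⟩ f ≈ ∑⟨ xs ⟩ (f ∘ g)
  ∑-map xs g f = reflexive (≡.cong (sumL F) (≡.sym (map-∘ xs)))

  subsets : (n : ℕ) → List (Subset n)
  subsets = allSubsets F

  ∑-subsets-suc : ∀ (f : Subset (suc n) → Carrier) →
                  ∑⟨ subsets (suc n) ⟩ f ≈ ∑⟨ subsets n ⟩ (f ∘ (false ∷_)) + ∑⟨ subsets n ⟩ (f ∘ (true ∷_))
  ∑-subsets-suc {n} f = trans (∑-++ (map (false ∷_) (subsets n)) _ f)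
                              (+-cong (∑-map (subsets n) _ f) (∑-map (subsets n) _ f))

  -- The product _*P_ with its coefficient selection made reducible: on concrete
  -- leading bits, (b ∷ A) == (c ∷ B) computes to does (b ≟ c) ∧ (A == B).
  mul : MLPoly F n → MLPoly F n → MLPoly F n
  mul {n} p q S = ∑⟨ subsets n ⟩ λ A → ∑⟨ subsets n ⟩ λ B → [ A ∪ B == S ]· (p A * q B)

  -- The left-hand side is the summand of the (where-local) definition of _*P_,
  -- which cannot be named here; it is inferred from the use in *P≈mul.
  *P-summand : ∀ (p q : MLPoly F n) S A B → _ ≈ [ A ∪ B == S ]· (p A * q B)

  *P≈mul : ∀ (p q : MLPoly F n) S → _*P_ F p q S ≈ mul p q S
  *P≈mul {n} p q S = trans (sumL-concatMap (subsets n) _)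
    (∑-cong (subsets n) λ A → ∑-cong (subsets n) (*P-summand p q S A))

  *P-summand p q S A B with ≡-dec Bool._≟_ (A ∪ B) S
  ... | yes _ = refl
  ... | no _ = refl

  constP-coeff : ∀ a (S : Subset n) → constP F a S ≈ [ S == ⊥ ]· a
  constP-coeff {n} a S with ≡-dec Bool._≟_ S ⊥
  ... | yes _ = refl
  ... | no _ = refl

  varP-coeff : ∀ (i : Fin n) S → varP F i S ≈ [ S == ⁅ i ⁆ ]· 1#
  varP-coeff i S with ≡-dec Bool._≟_ S ⁅ i ⁆
  ... | yes _ = refl
  ... | no _ = refl

  constP-⊥ : ∀ a → constP F a (⊥ {n}) ≈ a
  constP-⊥ {n} a =
    trans (constP-coeff a (⊥ {n})) (reflexive (≡.cong ([_]· a) (dec-true (≡-dec Bool._≟_ (⊥ {n}) ⊥) ≡.refl)))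

  -- Writing p = p₀ + x₀ p₁ with p₀, p₁ free of x₀, slice false p = p₀ and slice true p = p₁.
  slice : Bool → MLPoly F (suc n) → MLPoly F n
  slice b p A = p (b ∷ A)

  lift : MLPoly F n → MLPoly F (suc n)
  lift p (false ∷ A) = p A
  lift p (true ∷ A) = 0#

  constP-lift : ∀ a → _≈P_ F (constP F {suc n} a) (lift (constP F a))
  constP-lift a (false ∷ A) = trans (constP-coeff a (false ∷ A)) (sym (constP-coeff a A))
  constP-lift a (true ∷ A) = constP-coeff a (true ∷ A)

  mul-[] : ∀ (p q : MLPoly F 0) → mul p q [] ≈ p [] * q []
  mul-[] p q = trans (+-identityʳ _) (+-identityʳ _)

  ∑∑-zero : ∀ n → ∑⟨ subsets n ⟩ (λ _ → ∑⟨ subsets n ⟩ λ _ → 0#) ≈ 0#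
  ∑∑-zero n = trans (∑-cong (subsets n) λ _ → ∑-zero (subsets n)) (∑-zero (subsets n))

  mul-cong : ∀ {p p′ q q′ : MLPoly F n} → _≈P_ F p p′ → _≈P_ F q q′ → ∀ S → mul p q S ≈ mul p′ q′ S
  mul-cong {n} p≈p′ q≈q′ S =
    ∑-cong (subsets n) λ A → ∑-cong (subsets n) λ B → []·-cong (A ∪ B == S) (*-cong (p≈p′ A) (q≈q′ B))

  mul-zeroˡ : ∀ {p : MLPoly F n} q → (∀ A → p A ≈ 0#) → ∀ S → mul p q S ≈ 0#
  mul-zeroˡ {n} q p≈0 S = trans
    (∑-cong (subsets n) λ A → ∑-cong (subsets n) λ B →
      trans ([]·-cong (A ∪ B == S) (trans (*-congʳ (p≈0 A)) (zeroˡ _))) ([]·-zero (A ∪ B == S)))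
    (∑∑-zero n)

  mul-zeroʳ : ∀ p {q : MLPoly F n} → (∀ B → q B ≈ 0#) → ∀ S → mul p q S ≈ 0#
  mul-zeroʳ {n} p q≈0 S = trans
    (∑-cong (subsets n) λ A → ∑-cong (subsets n) λ B →
      trans ([]·-cong (A ∪ B == S) (trans (*-congˡ (q≈0 B)) (zeroʳ _))) ([]·-zero (A ∪ B == S)))
    (∑∑-zero n)

  mul-+ʳ : ∀ (p q r : MLPoly F n) S → mul p (_+P_ F q r) S ≈ mul p q S + mul p r S
  mul-+ʳ {n} p q r S = trans
    (∑-cong (subsets n) λ A → trans
      (∑-cong (subsets n) λ B → trans ([]·-cong (A ∪ B == S) (distribˡ _ _ _)) ([]·-+ (A ∪ B == S) _ _))
      (∑-+ (subsets n) _ _))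
    (∑-+ (subsets n) _ _)

  mul-negʳ : ∀ (p q : MLPoly F n) S → mul p (λ B → - q B) S ≈ - mul p q S
  mul-negʳ p q S = +-inverseˡ-unique _ _ (trans (sym (mul-+ʳ p _ q S)) (mul-zeroʳ p (λ B → -‿inverseˡ (q B)) S))

  block : Bool → Bool → MLPoly F (suc n) → MLPoly F (suc n) → Subset (suc n) → Carrier
  block {n} a b p q S =
    ∑⟨ subsets n ⟩ λ A → ∑⟨ subsets n ⟩ λ B → [ (a ∷ A) ∪ (b ∷ B) == S ]· (p (a ∷ A) * q (b ∷ B))

  mul-blocks : ∀ (p q : MLPoly F (suc n)) S →
               mul p q S ≈ (block false false p q S + block true false p q S)
                         + (block false true p q S + block true true p q S)
  mul-blocks {n} p q S = begin
    mul p q S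
      ≈⟨ ∑-cong (subsets (suc n)) (λ A → ∑-subsets-suc (summand A)) ⟩
    ∑⟨ subsets (suc n) ⟩ (λ A → half false A + half true A)
      ≈⟨ ∑-+ (subsets (suc n)) (half false) (half true) ⟩
    ∑⟨ subsets (suc n) ⟩ (half false) + ∑⟨ subsets (suc n) ⟩ (half true)
      ≈⟨ +-cong (∑-subsets-suc (half false)) (∑-subsets-suc (half true)) ⟩
    (block false false p q S + block true false p q S) + (block false true p q S + block true true p q S) ∎
    where
    summand : Subset (suc n) → Subset (suc n) → Carrier
    summand A B = [ A ∪ B == S ]· (p A * q B)
    half : Bool → Subset (suc n) → Carrier
    half b A = ∑⟨ subsets n ⟩ (summand A ∘ (b ∷_))

  -- (p₀ + x₀ p₁) (q₀ + x₀ q₁) = p₀ q₀ + x₀ (p₁ q₀ + p₀ q₁ + p₁ q₁) modulo x₀² - x₀: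
  -- the blocks not matching the x₀-bit of the target reduce to double sums of 0#.
  mul-false∷ : ∀ (p q : MLPoly F (suc n)) S → mul p q (false ∷ S) ≈ mul (slice false p) (slice false q) S
  mul-false∷ {n} p q S = begin
    mul p q (false ∷ S)                  ≈⟨ mul-blocks p q (false ∷ S) ⟩
    (mul p₀ q₀ S + Z) + (Z + Z)          ≈⟨ +-cong (+-congˡ (∑∑-zero n)) (+-cong (∑∑-zero n) (∑∑-zero n)) ⟩
    (mul p₀ q₀ S + 0#) + (0# + 0#)       ≈⟨ +-cong (+-identityʳ _) (+-identityʳ 0#) ⟩
    mul p₀ q₀ S + 0#                     ≈⟨ +-identityʳ _ ⟩
    mul p₀ q₀ S                          ∎
    where
    p₀ = slice false p
    q₀ = slice false q
    Z = ∑⟨ subsets n ⟩ λ _ → ∑⟨ subsets n ⟩ λ _ → 0#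

  mul-true∷ : ∀ (p q : MLPoly F (suc n)) S →
              mul p q (true ∷ S) ≈ mul (slice true p) (slice false q) S
                                   + (mul (slice false p) (slice true q) S + mul (slice true p) (slice true q) S)
  mul-true∷ {n} p q S = begin
    mul p q (true ∷ S)                                 ≈⟨ mul-blocks p q (true ∷ S) ⟩
    (Z + mul p₁ q₀ S) + (mul p₀ q₁ S + mul p₁ q₁ S)    ≈⟨ +-congʳ (trans (+-congʳ (∑∑-zero n)) (+-identityˡ _)) ⟩
    mul p₁ q₀ S + (mul p₀ q₁ S + mul p₁ q₁ S)          ∎
    where
    p₀ = slice false p
    q₀ = slice false q
    p₁ = slice true p
    q₁ = slice true q
    Z = ∑⟨ subsets n ⟩ λ _ → ∑⟨ subsets n ⟩ λ _ → 0#

  mul-liftˡ : ∀ (p : MLPoly F n) r b S → mul (lift p) r (b ∷ S) ≈ mul p (slice b r) S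
  mul-liftˡ p r false S = mul-false∷ (lift p) r S
  mul-liftˡ p r true S = trans (mul-true∷ (lift p) r S)
    (trans (+-cong (mul-zeroˡ _ (λ _ → refl) S) (+-congˡ (mul-zeroˡ _ (λ _ → refl) S)))
           (trans (+-identityˡ _) (+-identityʳ _)))

  mul-liftʳ : ∀ r (p : MLPoly F n) b S → mul r (lift p) (b ∷ S) ≈ mul (slice b r) p S
  mul-liftʳ r p false S = mul-false∷ r (lift p) S
  mul-liftʳ r p true S = trans (mul-true∷ r (lift p) S)
    (trans (+-congˡ (trans (+-cong (mul-zeroʳ _ (λ _ → refl) S) (mul-zeroʳ _ (λ _ → refl) S)) (+-identityʳ 0#)))
           (+-identityʳ _))

  mul-constˡ : ∀ a (q : MLPoly F n) S → mul (constP F a) q S ≈ a * q S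
  mul-constˡ a q [] = trans (mul-[] (constP F a) q) (*-congʳ (constP-coeff a []))
  mul-constˡ a q (b ∷ S) = trans (mul-cong (constP-lift a) (λ _ → refl) (b ∷ S))
    (trans (mul-liftˡ _ q b S) (mul-constˡ a (slice b q) S))

  mul-constʳ : ∀ (p : MLPoly F n) a S → mul p (constP F a) S ≈ p S * a
  mul-constʳ p a [] = trans (mul-[] p (constP F a)) (*-congˡ (constP-coeff a []))
  mul-constʳ p a (b ∷ S) = trans (mul-cong (λ _ → refl) (constP-lift a) (b ∷ S))
    (trans (mul-liftʳ p _ b S) (mul-constʳ (slice b p) a S))

  mul-⊥ : ∀ (p q : MLPoly F n) → mul p q ⊥ ≈ p ⊥ * q ⊥
  mul-⊥ {zero} p q = mul-[] p q
  mul-⊥ {suc n} p q = trans (mul-false∷ p q ⊥) (mul-⊥ (slice false p) (slice false q))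

  *P-cong : ∀ {p p′ q q′ : MLPoly F n} → _≈P_ F p p′ → _≈P_ F q q′ → _≈P_ F (_*P_ F p q) (_*P_ F p′ q′)
  *P-cong {p′ = p′} {q′ = q′} p≈p′ q≈q′ S =
    trans (*P≈mul _ _ S) (trans (mul-cong p≈p′ q≈q′ S) (sym (*P≈mul p′ q′ S)))

  *P-lift : ∀ (p q : MLPoly F n) → _≈P_ F (_*P_ F (lift p) (lift q)) (lift (_*P_ F p q))
  *P-lift p q (false ∷ S) =
    trans (*P≈mul (lift p) (lift q) _) (trans (mul-liftˡ p (lift q) false S) (sym (*P≈mul p q S)))
  *P-lift p q (true ∷ S) =
    trans (*P≈mul (lift p) (lift q) _) (trans (mul-liftˡ p (lift q) true S) (mul-zeroʳ p (λ _ → refl) S))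

  1-x : Fin n → MLPoly F n
  1-x i = _-P_ F (constP F 1#) (varP F i)

  ∏[1-x] : List (Fin n) → MLPoly F n
  ∏[1-x] = foldr (λ i acc → _*P_ F (1-x i) acc) (constP F 1#)

  e₀ : (n : ℕ) → MLPoly F n
  e₀ n = ∏[1-x] (allFin n)

  1-x-suc : ∀ (i : Fin n) → _≈P_ F (1-x (suc i)) (lift (1-x i))
  1-x-suc i (false ∷ A) =
    +-cong (constP-lift 1# (false ∷ A)) (-‿cong (trans (varP-coeff (suc i) (false ∷ A)) (sym (varP-coeff i A))))
  1-x-suc i (true ∷ A) =
    trans (+-cong (constP-coeff 1# (true ∷ A)) (-‿cong (varP-coeff (suc i) (true ∷ A)))) (trans (+-identityˡ _) -0#≈0#)

  slice-false-1-x₀ : _≈P_ F (slice false (1-x {suc n} zero)) (constP F 1#)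
  slice-false-1-x₀ A = trans (+-cong (constP-lift 1# (false ∷ A)) (-‿cong (varP-coeff zero (false ∷ A))))
                             (trans (+-congˡ -0#≈0#) (+-identityʳ _))

  slice-true-1-x₀ : _≈P_ F (slice true (1-x {suc n} zero)) (constP F (- 1#))
  slice-true-1-x₀ A = trans (+-cong (constP-coeff 1# (true ∷ A)) (-‿cong (varP-coeff zero (true ∷ A))))
    (trans (+-identityˡ _) (trans (sym ([]·-neg (A == ⊥) 1#)) (sym (constP-coeff (- 1#) A))))

  ∏[1-x]-map-suc : ∀ (L : List (Fin n)) → _≈P_ F (∏[1-x] (map suc L)) (lift (∏[1-x] L))
  ∏[1-x]-map-suc [] = constP-lift 1#
  ∏[1-x]-map-suc (i ∷ L) S = trans (*P-cong (1-x-suc i) (∏[1-x]-map-suc L) S) (*P-lift _ _ S)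

  e₀-suc : ∀ n → _≈P_ F (e₀ (suc n)) (_*P_ F (1-x zero) (lift (e₀ n)))
  e₀-suc n S = trans
    (reflexive (≡.cong (λ L → _*P_ F (1-x zero) (∏[1-x] L) S) (≡.sym (map-tabulate (λ i → i) suc))))
    (*P-cong (λ _ → refl) (∏[1-x]-map-suc (allFin n)) S)

  e₀-∷ : ∀ n b S → e₀ (suc n) (b ∷ S) ≈ mul (slice b (1-x zero)) (e₀ n) S
  e₀-∷ n b S = begin
    e₀ (suc n) (b ∷ S)                          ≈⟨ e₀-suc n (b ∷ S) ⟩
    _*P_ F (1-x zero) (lift (e₀ n)) (b ∷ S)     ≈⟨ *P≈mul (1-x zero) (lift (e₀ n)) (b ∷ S) ⟩
    mul (1-x zero) (lift (e₀ n)) (b ∷ S)        ≈⟨ mul-liftʳ (1-x zero) (e₀ n) b S ⟩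
    mul (slice b (1-x zero)) (e₀ n) S           ∎

  e₀-false∷ : ∀ n S → e₀ (suc n) (false ∷ S) ≈ e₀ n S
  e₀-false∷ n S = begin
    e₀ (suc n) (false ∷ S)                      ≈⟨ e₀-∷ n false S ⟩
    mul (slice false (1-x zero)) (e₀ n) S       ≈⟨ mul-cong slice-false-1-x₀ (λ _ → refl) S ⟩
    mul (constP F 1#) (e₀ n) S                  ≈⟨ mul-constˡ 1# (e₀ n) S ⟩
    1# * e₀ n S                                 ≈⟨ *-identityˡ _ ⟩
    e₀ n S                                      ∎

  e₀-true∷ : ∀ n S → e₀ (suc n) (true ∷ S) ≈ - e₀ n S
  e₀-true∷ n S = begin
    e₀ (suc n) (true ∷ S)                       ≈⟨ e₀-∷ n true S ⟩
    mul (slice true (1-x zero)) (e₀ n) S        ≈⟨ mul-cong slice-true-1-x₀ (λ _ → refl) S ⟩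
    mul (constP F (- 1#)) (e₀ n) S              ≈⟨ mul-constˡ (- 1#) (e₀ n) S ⟩
    - 1# * e₀ n S                               ≈⟨ -1*x≈-x _ ⟩
    - e₀ n S                                    ∎

  e₀-⊥ : ∀ n → e₀ n ⊥ ≈ 1#
  e₀-⊥ zero = constP-coeff 1# []
  e₀-⊥ (suc n) = trans (e₀-false∷ n ⊥) (e₀-⊥ n)

  sign : ℕ → Carrier
  sign zero = 1#
  sign (suc n) = - sign n

  sign-*-cancel : ∀ n → sign n * x ≈ 0# → x ≈ 0#
  sign-*-cancel zero 1x≈0 = trans (sym (*-identityˡ _)) 1x≈0
  sign-*-cancel (suc n) -sx≈0 =
    sign-*-cancel n (-‿injective (trans (-‿distribˡ-* _ _) (trans -sx≈0 (sym -0#≈0#))))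

  mul-e₀-⊤ : ∀ (g : MLPoly F n) → mul g (e₀ n) ⊤ ≈ sign n * g ⊥
  mul-e₀-⊤ {zero} g = trans (mul-[] g (e₀ 0)) (trans (*-congˡ (e₀-⊥ 0)) (trans (*-identityʳ _) (sym (*-identityˡ _))))
  mul-e₀-⊤ {suc n} g = begin
    mul g (e₀ (suc n)) ⊤
      ≈⟨ mul-true∷ g (e₀ (suc n)) ⊤ ⟩
    mul g₁ e₀⁰ ⊤ + (mul g₀ e₀¹ ⊤ + mul g₁ e₀¹ ⊤)
      ≈⟨ +-cong (mul-cong (λ _ → refl) (e₀-false∷ n) ⊤)
                (+-cong (mul-cong (λ _ → refl) (e₀-true∷ n) ⊤) (mul-cong (λ _ → refl) (e₀-true∷ n) ⊤)) ⟩
    mul g₁ (e₀ n) ⊤ + (mul g₀ (λ B → - e₀ n B) ⊤ + mul g₁ (λ B → - e₀ n B) ⊤)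
      ≈⟨ +-congˡ (+-cong (mul-negʳ g₀ (e₀ n) ⊤) (mul-negʳ g₁ (e₀ n) ⊤)) ⟩
    mul g₁ (e₀ n) ⊤ + (- mul g₀ (e₀ n) ⊤ + - mul g₁ (e₀ n) ⊤)
      ≈⟨ sym (+-assoc _ _ _) ⟩
    (mul g₁ (e₀ n) ⊤ + - mul g₀ (e₀ n) ⊤) + - mul g₁ (e₀ n) ⊤
      ≈⟨ xyx⁻¹≈y _ _ ⟩
    - mul g₀ (e₀ n) ⊤
      ≈⟨ -‿cong (mul-e₀-⊤ g₀) ⟩
    - (sign n * g ⊥)
      ≈⟨ -‿distribˡ-* _ _ ⟩
    sign (suc n) * g ⊥ ∎
    where
    g₀ = slice false g
    g₁ = slice true g
    e₀⁰ = slice false (e₀ (suc n))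
    e₀¹ = slice true (e₀ (suc n))

  *P-fPoly : ∀ (g : MLPoly F n) S → _*P_ F g (fPoly F n) S ≈ mul g (e₀ n) S - g S * (1# + 1#)
  *P-fPoly {n} g S = begin
    _*P_ F g (fPoly F n) S                                      ≈⟨ *P≈mul g (fPoly F n) S ⟩
    mul g (fPoly F n) S                                         ≈⟨ mul-+ʳ g (e₀ n) (λ B → - constP F (1# + 1#) B) S ⟩
    mul g (e₀ n) S + mul g (λ B → - constP F (1# + 1#) B) S     ≈⟨ +-congˡ (mul-negʳ g (constP F (1# + 1#)) S) ⟩
    mul g (e₀ n) S - mul g (constP F (1# + 1#)) S               ≈⟨ +-congˡ (-‿cong (mul-constʳ g (1# + 1#) S)) ⟩
    mul g (e₀ n) S - g S * (1# + 1#)                            ∎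

  x*1-x*[1+1]≈-x : ∀ x → x * 1# - x * (1# + 1#) ≈ - x
  x*1-x*[1+1]≈-x x = begin
    x * 1# - x * (1# + 1#)  ≈⟨ +-cong (*-identityʳ x) (-‿cong (trans (distribˡ x 1# 1#) (+-cong (*-identityʳ x) (*-identityʳ x)))) ⟩
    x - (x + x)             ≈⟨ +-congˡ (sym (-‿+-comm x x)) ⟩
    x + (- x - x)           ≈⟨ sym (+-assoc _ _ _) ⟩
    (x - x) - x             ≈⟨ +-congʳ (-‿inverseʳ x) ⟩
    0# - x                  ≈⟨ +-identityˡ _ ⟩
    - x                     ∎

  constant-coeff-nonzero : ∀ {g : MLPoly F n} → ¬ (1# ≈ 0#) → _≈P_ F (_*P_ F g (fPoly F n)) (constP F 1#) →
                           ¬ (g ⊥ ≈ 0#)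
  constant-coeff-nonzero {n} {g} 1≉0 gf≈1 g⊥≈0 = 1≉0 (begin
    1#                                    ≈⟨ sym (constP-⊥ {n} 1#) ⟩
    constP F 1# (⊥ {n})                   ≈⟨ sym (gf≈1 ⊥) ⟩
    _*P_ F g (fPoly F n) ⊥                ≈⟨ *P-fPoly g ⊥ ⟩
    mul g (e₀ n) ⊥ - g ⊥ * (1# + 1#)      ≈⟨ +-congʳ (trans (mul-⊥ g (e₀ n)) (*-congˡ (e₀-⊥ n))) ⟩
    g ⊥ * 1# - g ⊥ * (1# + 1#)            ≈⟨ x*1-x*[1+1]≈-x (g ⊥) ⟩
    - g ⊥                                 ≈⟨ -‿cong g⊥≈0 ⟩
    - 0#                                  ≈⟨ -0#≈0# ⟩
    0#                                    ∎)

  top-coeff-nonzero : ∀ {g : MLPoly F n} → ¬ (1# ≈ 0#) → _≈P_ F (_*P_ F g (fPoly F n)) (constP F 1#) → ¬ (g ⊤ ≈ 0#)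
  top-coeff-nonzero {zero} 1≉0 gf≈1 = constant-coeff-nonzero 1≉0 gf≈1     -- ⊤ = ⊥ = []
  top-coeff-nonzero {suc n} {g} 1≉0 gf≈1 g⊤≈0 = constant-coeff-nonzero 1≉0 gf≈1 (sign-*-cancel (suc n) (begin
    sign (suc n) * g ⊥                    ≈⟨ sym (mul-e₀-⊤ g) ⟩
    mul g (e₀ (suc n)) ⊤                  ≈⟨ sym (+-identityʳ _) ⟩
    mul g (e₀ (suc n)) ⊤ + 0#             ≈⟨ +-congˡ (sym (trans (-‿cong (trans (*-congʳ g⊤≈0) (zeroˡ _))) -0#≈0#)) ⟩
    mul g (e₀ (suc n)) ⊤ - g ⊤ * (1# + 1#) ≈⟨ sym (*P-fPoly g ⊤) ⟩
    _*P_ F g (fPoly F (suc n)) ⊤          ≈⟨ gf≈1 ⊤ ⟩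
    constP F 1# (⊤ {suc n})               ≈⟨ constP-coeff {suc n} 1# ⊤ ⟩
    0#                                    ∎))

lemma5p1 : ∀ {c ℓ} (F : CommutativeRing c ℓ) → IsField F → IsFinite F →
           (q : ℕ) → HasCharacteristic F q → 2 < q →
           (n : ℕ) (g : MLPoly F n) →
           _≈P_ F (_*P_ F g (fPoly F n)) (constP F (CommutativeRing.1# F)) →
           HasDegree F g n
lemma5p1 F (1≉0 , _) _ _ _ _ n g gf≈1 =
  (⊤ , ∣⊤∣≡n n , Coefficients.top-coeff-nonzero F 1≉0 gf≈1) , λ S _ → ∣p∣≤n S
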